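{- Let $G$ be a $2$-connected graph. Then $\overline{G}$ is $2$-connected if and only if $G$ has no complete bipartite subgraph whose vertex set has at least $|V(G)|-1$ vertices.
   Context: All graphs are finite and simple; $\overline{G}$ denotes the complement of $G$. A graph is $2$-connected if it has at least three vertices, is connected, and has no cut vertex. A complete bipartite subgraph means a (not necessarily induced) subgraph isomorphic to $K_{m,n}$ with $m,n \ge 1$. -}

module Defs where

open import Data.Nat using (ℕ; _≤_; _∸_; _+_)
open import Data.Fin using (Fin)
open import Data.Fin.Subset using (Subset; _∈_; ∣_∣)
open import Data.Product using (Σ; ∃; _×_; _,_)
open import Data.Unit using (⊤)
open import Relation.Nullary using (¬_; Dec)
open import Relation.Binary.PropositionalEquality using (_≡_; _≢_)
open import Data.Nat using (_≥_)

record Graph (n : ℕ) : Set₁ where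
  field
    Adj    : Fin n → Fin n → Set
    sym    : ∀ {u v} → Adj u v → Adj v u
    irrefl : ∀ {u} → ¬ Adj u u
    dec    : ∀ u v → Dec (Adj u v)
open Graph public

complement : ∀ {n} → Graph n → Graph n
complement {n} G = record
  { Adj    = λ u v → (u ≢ v) × ¬ Adj G u v
  ; sym    = λ { (u≢v , ¬a) → (λ e → u≢v (≡sym e)) , (λ a → ¬a (Graph.sym G a)) }
  ; irrefl = λ { (u≢u , _) → u≢u _≡_.refl }
  ; dec    = decC
  }
  where
  open import Relation.Binary.PropositionalEquality using () renaming (sym to ≡sym)
  open import Relation.Nullary using (yes; no)
  open import Data.Fin using (_≟_)
  decC : ∀ u v → Dec ((u ≢ v) × ¬ Adj G u v)
  decC u v with u ≟ v | Graph.dec G u v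
  ... | yes e | _     = no (λ { (u≢v , _) → u≢v e })
  ... | no ne | yes a = no (λ { (_ , ¬a) → ¬a a })
  ... | no ne | no ¬a = yes (ne , ¬a)

data WalkIn {n : ℕ} (G : Graph n) (P : Fin n → Set) : Fin n → Fin n → Set where
  [_]  : ∀ {u} → P u → WalkIn G P u u
  _∷_  : ∀ {u w v} → P u → Adj G u w × WalkIn G P w v → WalkIn G P u v

Connected : ∀ {n} → Graph n → Set
Connected {n} G = ∀ (u v : Fin n) → WalkIn G (λ _ → ⊤) u v

NoCutVertex : ∀ {n} → Graph n → Set
NoCutVertex {n} G =
  ∀ (x u v : Fin n) → u ≢ x → v ≢ x → WalkIn G (λ w → w ≢ x) u v

TwoConnected : ∀ {n} → Graph n → Set
TwoConnected {n} G = (n ≥ 3) × Connected G × NoCutVertex G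

LargeCompleteBipartite : ∀ {n} → Graph n → Set
LargeCompleteBipartite {n} G =
  Σ (Subset n) λ A → Σ (Subset n) λ B →
    (∃ λ a → a ∈ A) × (∃ λ b → b ∈ B) ×
    (∀ i → ¬ (i ∈ A × i ∈ B)) ×
    (∀ a b → a ∈ A → b ∈ B → Adj G a b) ×
    (n ∸ 1 ≤ ∣ A ∣ + ∣ B ∣)

-- If G contains K_{A,B} with |A| + |B| ≥ n − 1, then no edge of the complement joins A to B,
-- and at most one vertex x lies outside A ∪ B; so the complement (minus x, if there is one)
-- has no walk from A to B. Conversely, if removing x disconnects the complement, take the
-- component R of a vertex u ≠ x and let B be the rest of V ∖ {x}: every pair in R × B is a
-- non-edge of the complement, i.e. an edge of G, and |R| + |B| = n − 1. With n ≥ 3, having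
-- no cut vertex already implies connectivity.

module Submission where

open import Defs
open import Data.Nat using (ℕ; suc; _≤_; _+_; _∸_; z≤n; s≤s; _≥_)
open import Data.Nat.Properties
  using (≤-trans; ≤-reflexive; +-suc; +-monoʳ-≤; ∸-monoʳ-≤; ∸-+-assoc; m≤n+m∸n; 1+n≰n; module ≤-Reasoning)
open import Data.Fin using (Fin; zero; suc; _≟_)
open import Data.Fin.Properties using (any?)
open import Data.Fin.Subset using (Subset; _∈_; _∉_; _⊂_; _⊃_; ∣_∣; _∪_; ∁; ⁅_⁆; inside; outside)
open import Data.Fin.Subset.Properties
  using (_∈?_; p⊂q⇒∣p∣<∣q∣; q⊆p∪q; x∈p∪q⁺; x∈p∪q⁻; x∈⁅x⁆; x∈⁅y⁆⇒x≡y; x∉⁅y⁆⇒x≢y; ∣⁅x⁆∣≡1;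
         ∣p∣≤∣x∷p∣; ∣p∣≤n; ∣∁p∣≡n∸∣p∣; x∈∁p⇒x∉p; x∉p⇒x∈∁p)
open import Data.Fin.Subset.Induction using (Acc; acc; ⊃-wellFounded)
open import Data.Vec using ([]; _∷_; here; there)
open import Data.Product using (Σ-syntax; ∃; _×_; _,_; proj₂)
open import Data.Sum using (_⊎_; inj₁; inj₂; [_,_]′)
open import Data.Empty using (⊥; ⊥-elim)
open import Data.Unit using (tt)
open import Function using (_∘_)
open import Relation.Nullary using (¬_; yes; no; ¬?; _×-dec_)
open import Relation.Nullary.Decidable using (decidable-stable)
open import Relation.Unary using (Decidable)
open import Relation.Binary.PropositionalEquality using (_≡_; _≢_; refl; cong) renaming (sym to ≡-sym)

drop-disjoint : ∀ {n s t} {p q : Subset n} → (∀ i → ¬ (i ∈ s ∷ p × i ∈ t ∷ q)) →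
  ∀ i → ¬ (i ∈ p × i ∈ q)
drop-disjoint disjoint i (i∈p , i∈q) = disjoint (suc i) (there i∈p , there i∈q)

∣p∪q∣≤∣p∣+∣q∣ : ∀ {n} (p q : Subset n) → ∣ p ∪ q ∣ ≤ ∣ p ∣ + ∣ q ∣
∣p∪q∣≤∣p∣+∣q∣ []            []            = z≤n
∣p∪q∣≤∣p∣+∣q∣ (inside  ∷ p) (s       ∷ q) =
  s≤s (≤-trans (∣p∪q∣≤∣p∣+∣q∣ p q) (+-monoʳ-≤ ∣ p ∣ (∣p∣≤∣x∷p∣ s q)))
∣p∪q∣≤∣p∣+∣q∣ (outside ∷ p) (inside  ∷ q) =
  ≤-trans (s≤s (∣p∪q∣≤∣p∣+∣q∣ p q)) (≤-reflexive (≡-sym (+-suc ∣ p ∣ ∣ q ∣)))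
∣p∪q∣≤∣p∣+∣q∣ (outside ∷ p) (outside ∷ q) = ∣p∪q∣≤∣p∣+∣q∣ p q

∣p∣+∣q∣≤∣p∪q∣ : ∀ {n} (p q : Subset n) → (∀ i → ¬ (i ∈ p × i ∈ q)) → ∣ p ∣ + ∣ q ∣ ≤ ∣ p ∪ q ∣
∣p∣+∣q∣≤∣p∪q∣ []            []            _        = z≤n
∣p∣+∣q∣≤∣p∪q∣ (inside  ∷ p) (inside  ∷ q) disjoint with () ← disjoint zero (here , here)
∣p∣+∣q∣≤∣p∪q∣ (inside  ∷ p) (outside ∷ q) disjoint = s≤s (∣p∣+∣q∣≤∣p∪q∣ p q (drop-disjoint disjoint))
∣p∣+∣q∣≤∣p∪q∣ (outside ∷ p) (inside  ∷ q) disjoint =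
  ≤-trans (≤-reflexive (+-suc ∣ p ∣ ∣ q ∣)) (s≤s (∣p∣+∣q∣≤∣p∪q∣ p q (drop-disjoint disjoint)))
∣p∣+∣q∣≤∣p∪q∣ (outside ∷ p) (outside ∷ q) disjoint = ∣p∣+∣q∣≤∣p∪q∣ p q (drop-disjoint disjoint)

x∉p⇒p⊂⁅x⁆∪p : ∀ {n} {x : Fin n} {p : Subset n} → x ∉ p → p ⊂ ⁅ x ⁆ ∪ p
x∉p⇒p⊂⁅x⁆∪p {x = x} {p} x∉p = q⊆p∪q ⁅ x ⁆ p , x , x∈p∪q⁺ (inj₁ (x∈⁅x⁆ x)) , x∉p

x∉⁅y⁆∪p⁺ : ∀ {n} {x y : Fin n} {p : Subset n} → x ≢ y → x ∉ p → x ∉ ⁅ y ⁆ ∪ p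
x∉⁅y⁆∪p⁺ x≢y x∉p x∈ = [ x≢y ∘ x∈⁅y⁆⇒x≡y _ , x∉p ]′ (x∈p∪q⁻ _ _ x∈)

x∉⁅y⁆∪p⁻ : ∀ {n} {x y : Fin n} {p : Subset n} → x ∉ ⁅ y ⁆ ∪ p → x ≢ y × x ∉ p
x∉⁅y⁆∪p⁻ x∉ = x∉⁅y⁆⇒x≢y (x∉ ∘ x∈p∪q⁺ ∘ inj₁) , x∉ ∘ x∈p∪q⁺ ∘ inj₂

at-most-one-outside : ∀ {n} {U : Subset n} {x y : Fin n} → n ∸ 1 ≤ ∣ U ∣ → x ∉ U → y ∉ U → x ≡ y
at-most-one-outside {n} {U} {x} {y} big x∉U y∉U = decidable-stable (x ≟ y) λ x≢y → 1+n≰n (begin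
  suc (suc ∣ U ∣)         ≤⟨ s≤s (p⊂q⇒∣p∣<∣q∣ (x∉p⇒p⊂⁅x⁆∪p y∉U)) ⟩
  suc ∣ ⁅ y ⁆ ∪ U ∣        ≤⟨ p⊂q⇒∣p∣<∣q∣ (x∉p⇒p⊂⁅x⁆∪p (x∉⁅y⁆∪p⁺ x≢y x∉U)) ⟩
  ∣ ⁅ x ⁆ ∪ (⁅ y ⁆ ∪ U) ∣  ≤⟨ ∣p∣≤n (⁅ x ⁆ ∪ (⁅ y ⁆ ∪ U)) ⟩
  n                       ≤⟨ m≤n+m∸n n 1 ⟩
  suc (n ∸ 1)             ≤⟨ s≤s big ⟩
  suc ∣ U ∣               ∎)
  where open ≤-Reasoning

all-or-all-but-one : ∀ {n} {U : Subset n} → n ∸ 1 ≤ ∣ U ∣ →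
  (∀ w → w ∈ U) ⊎ ∃ λ x → x ∉ U × (∀ w → w ≢ x → w ∈ U)
all-or-all-but-one {U = U} big with any? (λ x → ¬? (x ∈? U))
... | no none = inj₁ λ w → decidable-stable (w ∈? U) λ w∉U → none (w , w∉U)
... | yes (x , x∉U) = inj₂ (x , x∉U , λ w w≢x →
      decidable-stable (w ∈? U) λ w∉U → w≢x (at-most-one-outside big w∉U x∉U))

n∸1≤∣p∣+∣∁⁅x⁆∪p∣ : ∀ {n} (x : Fin n) (p : Subset n) → n ∸ 1 ≤ ∣ p ∣ + ∣ ∁ (⁅ x ⁆ ∪ p) ∣
n∸1≤∣p∣+∣∁⁅x⁆∪p∣ {n} x p = begin
  n ∸ 1                   ≤⟨ m≤n+m∸n (n ∸ 1) ∣ p ∣ ⟩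
  ∣ p ∣ + (n ∸ 1 ∸ ∣ p ∣)  ≡⟨ cong (∣ p ∣ +_) (∸-+-assoc n 1 ∣ p ∣) ⟩
  ∣ p ∣ + (n ∸ suc ∣ p ∣)  ≤⟨ +-monoʳ-≤ ∣ p ∣ (∸-monoʳ-≤ n ∣⁅x⁆∪p∣≤1+∣p∣) ⟩
  ∣ p ∣ + (n ∸ ∣ ⁅ x ⁆ ∪ p ∣) ≡⟨ cong (∣ p ∣ +_) (≡-sym (∣∁p∣≡n∸∣p∣ (⁅ x ⁆ ∪ p))) ⟩
  ∣ p ∣ + ∣ ∁ (⁅ x ⁆ ∪ p) ∣ ∎
  where
  open ≤-Reasoning
  ∣⁅x⁆∪p∣≤1+∣p∣ : ∣ ⁅ x ⁆ ∪ p ∣ ≤ suc ∣ p ∣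
  ∣⁅x⁆∪p∣≤1+∣p∣ = ≤-trans (∣p∪q∣≤∣p∣+∣q∣ ⁅ x ⁆ p) (≤-reflexive (cong (_+ ∣ p ∣) (∣⁅x⁆∣≡1 x)))

head : ∀ {n} {G : Graph n} {P : Fin n → Set} {u v} → WalkIn G P u v → P u
head [ pu ]   = pu
head (pu ∷ _) = pu

extend : ∀ {n} {G : Graph n} {P : Fin n → Set} {u v w} →
  WalkIn G P u v → Adj G v w → P w → WalkIn G P u w
extend [ pu ]             adj pw = pu ∷ (adj , [ pw ])
extend (pu ∷ (adj′ , vs)) adj pw = pu ∷ (adj′ , extend vs adj pw)

WalkIn-mono : ∀ {n} {G : Graph n} {P Q : Fin n → Set} {u v} → (∀ w → P w → Q w) →
  WalkIn G P u v → WalkIn G Q u v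
WalkIn-mono P⇒Q [ pu ]            = [ P⇒Q _ pu ]
WalkIn-mono P⇒Q (pu ∷ (adj , vs)) = P⇒Q _ pu ∷ (adj , WalkIn-mono P⇒Q vs)

third-vertex : ∀ {n} → 3 ≤ n → (u v : Fin n) → ∃ λ x → u ≢ x × v ≢ x
third-vertex (s≤s (s≤s (s≤s z≤n))) zero          zero          = suc zero , (λ ()) , (λ ())
third-vertex (s≤s (s≤s (s≤s z≤n))) zero          (suc zero)    = suc (suc zero) , (λ ()) , (λ ())
third-vertex (s≤s (s≤s (s≤s z≤n))) zero          (suc (suc _)) = suc zero , (λ ()) , (λ ())
third-vertex (s≤s (s≤s (s≤s z≤n))) (suc zero)    zero          = suc (suc zero) , (λ ()) , (λ ())
third-vertex (s≤s (s≤s (s≤s z≤n))) (suc zero)    (suc _)       = zero , (λ ()) , (λ ())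
third-vertex (s≤s (s≤s (s≤s z≤n))) (suc (suc _)) zero          = suc zero , (λ ()) , (λ ())
third-vertex (s≤s (s≤s (s≤s z≤n))) (suc (suc _)) (suc _)       = zero , (λ ()) , (λ ())

noCutVertex⇒connected : ∀ {n} (G : Graph n) → n ≥ 3 → NoCutVertex G → Connected G
noCutVertex⇒connected G n≥3 noCut u v with third-vertex n≥3 u v
... | x , u≢x , v≢x = WalkIn-mono (λ _ _ → tt) (noCut x u v u≢x v≢x)

Closed : ∀ {n} → Graph n → (Fin n → Set) → Subset n → Set
Closed H P R = ∀ {y w} → y ∈ R → Adj H y w → P w → w ∈ R

module _ {n} (H : Graph n) {P : Fin n → Set} (P? : Decidable P) {u : Fin n} where

  private
    Exit : Subset n → Fin n → Set
    Exit R w = w ∉ R × P w × ∃ λ y → y ∈ R × Adj H y w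

    exit? : ∀ R → Decidable (Exit R)
    exit? R w = ¬? (w ∈? R) ×-dec P? w ×-dec any? (λ y → y ∈? R ×-dec dec H y w)

    ReachableClosedSet : Set
    ReachableClosedSet =
      Σ[ R ∈ Subset n ] u ∈ R × (∀ {v} → v ∈ R → WalkIn H P u v) × Closed H P R

    grow : ∀ R → Acc _⊃_ R → u ∈ R → (∀ {v} → v ∈ R → WalkIn H P u v) → ReachableClosedSet
    grow R (acc larger) u∈R walk with any? (exit? R)
    ... | no noExit = R , u∈R , walk , λ {y} {w} y∈R adj pw →
          decidable-stable (w ∈? R) λ w∉R → noExit (w , w∉R , pw , y , y∈R , adj)
    ... | yes (w , w∉R , pw , y , y∈R , adj) =
          grow (⁅ w ⁆ ∪ R) (larger (x∉p⇒p⊂⁅x⁆∪p w∉R)) (q⊆p∪q ⁅ w ⁆ R u∈R) walk′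
      where
      walk′ : ∀ {v} → v ∈ ⁅ w ⁆ ∪ R → WalkIn H P u v
      walk′ v∈ with x∈p∪q⁻ ⁅ w ⁆ R v∈
      ... | inj₁ v∈⁅w⁆ with refl ← x∈⁅y⁆⇒x≡y w v∈⁅w⁆ = extend (walk y∈R) adj pw
      ... | inj₂ v∈R = walk v∈R

  reachable-closed-set : P u → ReachableClosedSet
  reachable-closed-set pu = grow ⁅ u ⁆ (⊃-wellFounded ⁅ u ⁆) (x∈⁅x⁆ u) walk
    where
    walk : ∀ {v} → v ∈ ⁅ u ⁆ → WalkIn H P u v
    walk v∈⁅u⁆ with refl ← x∈⁅y⁆⇒x≡y u v∈⁅u⁆ = [ pu ]

no-crossing-walk : ∀ {n} (G : Graph n) {A B : Subset n} {P : Fin n → Set} {a b} →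
  (∀ a b → a ∈ A → b ∈ B → Adj G a b) → (∀ w → P w → w ∈ A ⊎ w ∈ B) →
  WalkIn (complement G) P a b → a ∈ A → b ∈ B → ⊥
no-crossing-walk G complete cover [ _ ] a∈A a∈B = irrefl G (complete _ _ a∈A a∈B)
no-crossing-walk G complete cover (_ ∷ (adj , ws)) a∈A b∈B with cover _ (head ws)
... | inj₁ w∈A = no-crossing-walk G complete cover ws w∈A b∈B
... | inj₂ w∈B = proj₂ adj (complete _ _ a∈A w∈B)

complement-twoConnected⇒¬large : ∀ {n} (G : Graph n) →
  TwoConnected (complement G) → ¬ LargeCompleteBipartite G
complement-twoConnected⇒¬large G (_ , connected , noCut)
  (A , B , (a , a∈A) , (b , b∈B) , disjoint , complete , big)
  with all-or-all-but-one (≤-trans big (∣p∣+∣q∣≤∣p∪q∣ A B disjoint))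
... | inj₁ all =
  no-crossing-walk G complete (λ w _ → x∈p∪q⁻ A B (all w)) (connected a b) a∈A b∈B
... | inj₂ (x , x∉U , almost) =
  no-crossing-walk G complete (λ w w≢x → x∈p∪q⁻ A B (almost w w≢x))
    (noCut x a b (distinct (x∈p∪q⁺ (inj₁ a∈A))) (distinct (x∈p∪q⁺ (inj₂ b∈B)))) a∈A b∈B
  where
  distinct : ∀ {w} → w ∈ A ∪ B → w ≢ x
  distinct w∈U refl = x∉U w∈U

closed⇒complete : ∀ {n} (G : Graph n) {x : Fin n} {R : Subset n} →
  Closed (complement G) (_≢ x) R → ∀ a b → a ∈ R → b ∈ ∁ (⁅ x ⁆ ∪ R) → Adj G a b
closed⇒complete G closed a b a∈R b∈B with x∉⁅y⁆∪p⁻ (x∈∁p⇒x∉p b∈B)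
... | b≢x , b∉R = decidable-stable (dec G a b) λ ¬adj →
  b∉R (closed a∈R ((λ { refl → b∉R a∈R }) , ¬adj) b≢x)

¬large⇒complement-noCutVertex : ∀ {n} (G : Graph n) →
  ¬ LargeCompleteBipartite G → NoCutVertex (complement G)
¬large⇒complement-noCutVertex G ¬large x u v u≢x v≢x
  with reachable-closed-set (complement G) (λ w → ¬? (w ≟ x)) u≢x
... | R , u∈R , walk , closed with v ∈? R
...   | yes v∈R = walk v∈R
...   | no v∉R  = ⊥-elim (¬large (R , ∁ (⁅ x ⁆ ∪ R) , (u , u∈R) , (v , x∉p⇒x∈∁p (x∉⁅y⁆∪p⁺ v≢x v∉R)) ,
                                  disjoint , closed⇒complete G closed , n∸1≤∣p∣+∣∁⁅x⁆∪p∣ x R))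
  where
  disjoint : ∀ i → ¬ (i ∈ R × i ∈ ∁ (⁅ x ⁆ ∪ R))
  disjoint i (i∈R , i∈B) = x∈∁p⇒x∉p i∈B (x∈p∪q⁺ (inj₂ i∈R))

proposition2p10 : ∀ {n : ℕ} (G : Graph n) → TwoConnected G →
    (TwoConnected (complement G) → ¬ LargeCompleteBipartite G) ×
    (¬ LargeCompleteBipartite G → TwoConnected (complement G))
proposition2p10 G (n≥3 , _ , _) =
  complement-twoConnected⇒¬large G ,
  λ ¬large → let noCut = ¬large⇒complement-noCutVertex G ¬large in
             n≥3 , noCutVertex⇒connected (complement G) n≥3 noCut , noCut
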